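{- Let $G$ be a (finite, simple) graph on $n$ vertices with $n\ge 16$, with maximum degree $\Delta(G)$ and minimum degree $\delta(G)$. Then there are disjoint vertex sets $A,B\subseteq V(G)$ such that at least one of the following holds: (i) ${\rm disc}(A,B)\le 2\lg^2 n$ and $|A|=|B|\ge (n-2\lg n)/2$; or (ii) ${\rm disc}(A,B)\le (\Delta(G)-\delta(G)+1)/2$ and $|A|=|B|=\lfloor n/2\rfloor$.
   Context: For a vertex set $X$, $e(X)$ denotes the number of edges of $G$ with both endpoints in $X$. For disjoint vertex sets $A,B$, the discrepancy is ${\rm disc}(A,B)=|e(A)-e(B)|$. $\lg$ denotes the logarithm in base $2$. -}

module Defs where

open import Data.Bool using (Bool; true; false; if_then_else_; _∧_)
open import Data.Nat using (ℕ; _+_; _*_; _^_; _≤_; _<_; _⊔_; _⊓_; _<ᵇ_; ∣_-_∣)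
open import Data.Fin using (Fin; toℕ)
open import Data.Fin.Subset using (Subset; _∈_)
open import Data.List using (List; map; allFin; foldr)
open import Data.Nat.ListAction using (sum)
open import Data.Vec using (lookup)
open import Data.Product using (_×_)
open import Relation.Nullary using (¬_)
open import Relation.Binary.PropositionalEquality using (_≡_)

record Graph (n : ℕ) : Set where
  field
    adj    : Fin n → Fin n → Bool
    sym    : ∀ i j → adj i j ≡ adj j i
    irrefl : ∀ i → adj i i ≡ false
open Graph public

count : ∀ {n} → (Fin n → Bool) → ℕ
count {n} f = sum (map (λ i → if f i then 1 else 0) (allFin n))

deg : ∀ {n} → Graph n → Fin n → ℕ
deg G i = count (adj G i)

maxDeg : ∀ {n} → Graph n → ℕ
maxDeg {n} G = foldr _⊔_ 0 (map (deg G) (allFin n))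

-- minimum degree δ(G) (initial value n exceeds every degree; only used for n ≥ 1)
minDeg : ∀ {n} → Graph n → ℕ
minDeg {n} G = foldr _⊓_ n (map (deg G) (allFin n))

e : ∀ {n} → Graph n → Subset n → ℕ
e {n} G X = sum (map (λ i → count (λ j →
          lookup X i ∧ lookup X j ∧ adj G i j ∧ (toℕ i <ᵇ toℕ j))) (allFin n))

disc : ∀ {n} → Graph n → Subset n → Subset n → ℕ
disc G A B = ∣ e G A - e G B ∣

Disjoint : ∀ {n} → Subset n → Subset n → Set
Disjoint {n} A B = ∀ (i : Fin n) → ¬ (i ∈ A × i ∈ B)

-- d ≤ 2 (lg n)^2, stated exactly without reals:
-- lg n ≥ sqrt(d/2) iff for every rational p/q with p/q < sqrt(d/2)
-- (i.e. 2 p^2 < d q^2) we have lg n ≥ p/q, i.e. 2^p ≤ n^q.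
LeTwoLgSq : ℕ → ℕ → Set
LeTwoLgSq d n = ∀ (p q : ℕ) → 0 < q → 2 * (p * p) < d * (q * q) → 2 ^ p ≤ n ^ q

-- Pair the vertices up as {0,1}, {2,3}, … (leaving the last one alone when n is odd) and let
-- d(v) count the neighbours of v among the paired vertices, so δ − 1 ≤ d(v) ≤ Δ.  Putting one
-- vertex of each pair into A and the other into B, greedily in the direction that keeps the
-- running totals of d close, gives |∑_A d − ∑_B d| ≤ Δ − δ + 1.  Since A ∪ B is exactly the set
-- of paired vertices, ∑_A d = 2 e(A) + e(A,B) and ∑_B d = 2 e(B) + e(A,B), so 2 disc(A,B) is that
-- difference.  Thus alternative (ii) holds for every graph, and the hypothesis n ≥ 16 is unused.
module Submission where

open import Defs
open import Data.Nat using (ℕ; _+_; _*_; _∸_; _^_; _≤_; _/_)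
open import Data.Fin.Subset using (Subset; ∣_∣)
open import Data.Product using (Σ; _×_)
open import Data.Sum using (_⊎_)
open import Relation.Binary.PropositionalEquality using (_≡_)

open import Data.Bool using (Bool; true; false; if_then_else_; _∧_; _∨_; not)
open import Data.Bool.Properties using (∧-inverseˡ; ∧-inverseʳ; ∨-inverseˡ; ∨-inverseʳ)
open import Data.Fin using (Fin; zero; suc; toℕ)
open import Data.Fin.Properties using (toℕ-injective)
open import Data.Fin.Subset using (_∈_; _∩_; _∪_; ⊥)
open import Data.Fin.Subset.Properties using (x∈p∩q⁺; ∉⊥)
open import Data.List using (map; foldr; allFin; tabulate)
open import Data.List.Membership.Propositional using () renaming (_∈_ to _∈ˡ_)
open import Data.List.Membership.Propositional.Properties using (∈-map⁺; ∈-allFin)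
open import Data.List.Relation.Unary.Any using (here; there)
import Data.Nat.ListAction as List
open import Data.Nat using (zero; suc; z≤n; s≤s; _⊔_; _⊓_; _<ᵇ_; ∣_-_∣)
open import Data.Nat.Properties
open import Data.Nat.DivMod using (m/n≡1+[m∸n]/n)
open import Data.Product using (_,_)
open import Data.Sum using (inj₁; inj₂)
open import Data.Vec using ([]; _∷_; lookup)
open import Data.Vec.Properties using (lookup-zipWith; lookup-replicate)
open import Function using (_∘_)
open import Relation.Nullary using (contradiction)
import Relation.Binary.PropositionalEquality as ≡
open ≡ using (refl; trans; cong; cong₂; subst; _≢_; module ≡-Reasoning)
open import Algebra.Properties.CommutativeMonoid.Sum +-0-commutativeMonoid
  using (sum; sum-syntax; sum-cong-≗; sum-replicate-zero; ∑-distrib-+; ∑-comm)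

[_] : Bool → ℕ
[ b ] = if b then 1 else 0

list-sum-map-tabulate : ∀ {m} {A : Set} (f : A → ℕ) (g : Fin m → A) →
  List.sum (map f (tabulate g)) ≡ sum (f ∘ g)
list-sum-map-tabulate {zero}  f g = refl
list-sum-map-tabulate {suc m} f g = cong (f (g zero) +_) (list-sum-map-tabulate f (g ∘ suc))

list-sum-map-allFin : ∀ {n} (f : Fin n → ℕ) → List.sum (map f (allFin n)) ≡ sum f
list-sum-map-allFin f = list-sum-map-tabulate f (λ i → i)

∑-mono-≤ : ∀ {n} {f g : Fin n → ℕ} → (∀ i → f i ≤ g i) → sum f ≤ sum g
∑-mono-≤ {zero}  f≤g = z≤n
∑-mono-≤ {suc n} f≤g = +-mono-≤ (f≤g zero) (∑-mono-≤ (f≤g ∘ suc))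

[x∧y]≤[y] : ∀ x y → [ x ∧ y ] ≤ [ y ]
[x∧y]≤[y] false y = z≤n
[x∧y]≤[y] true  y = ≤-refl

[y]≤[x∧y]+[¬x] : ∀ x y → [ y ] ≤ [ x ∧ y ] + [ not x ]
[y]≤[x∧y]+[¬x] false false = z≤n
[y]≤[x∧y]+[¬x] false true  = ≤-refl
[y]≤[x∧y]+[¬x] true  y     = m≤m+n [ y ] 0

[x∧[p∨q]∧r] : ∀ x p q r → p ∧ q ≡ false → [ x ∧ (p ∨ q) ∧ r ] ≡ [ x ∧ p ∧ r ] + [ x ∧ q ∧ r ]
[x∧[p∨q]∧r] false p     q     r pq = refl
[x∧[p∨q]∧r] true  false q     r pq = refl
[x∧[p∨q]∧r] true  true  false r pq = ≡.sym (+-identityʳ [ r ])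

[m<ᵇn]+[n<ᵇm]≡1 : ∀ {m n} → m ≢ n → [ m <ᵇ n ] + [ n <ᵇ m ] ≡ 1
[m<ᵇn]+[n<ᵇm]≡1 {zero}  {zero}  m≢n = contradiction refl m≢n
[m<ᵇn]+[n<ᵇm]≡1 {zero}  {suc n} m≢n = refl
[m<ᵇn]+[n<ᵇm]≡1 {suc m} {zero}  m≢n = refl
[m<ᵇn]+[n<ᵇm]≡1 {suc m} {suc n} m≢n = [m<ᵇn]+[n<ᵇm]≡1 (m≢n ∘ cong suc)

≤-foldr-⊔ : ∀ {x z xs} → x ∈ˡ xs → x ≤ foldr _⊔_ z xs
≤-foldr-⊔ (here refl) = m≤m⊔n _ _
≤-foldr-⊔ (there x∈xs) = ≤-trans (≤-foldr-⊔ x∈xs) (m≤n⊔m _ _)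

foldr-⊓-≤ : ∀ {x z xs} → x ∈ˡ xs → foldr _⊓_ z xs ≤ x
foldr-⊓-≤ (here refl) = m⊓n≤m _ _
foldr-⊓-≤ (there x∈xs) = ≤-trans (m⊓n≤n _ _) (foldr-⊓-≤ x∈xs)

Close : ℕ → ℕ → ℕ → Set
Close s x y = x ≤ y + s × y ≤ x + s

Close-sym : ∀ {s x y} → Close s x y → Close s y x
Close-sym (x≤y+s , y≤x+s) = y≤x+s , x≤y+s

Close⇒∣-∣≤ : ∀ {s x y} → Close s x y → ∣ x - y ∣ ≤ s
Close⇒∣-∣≤ {s} {x} {y} (x≤y+s , y≤x+s) with ≤-total x y
... | inj₁ x≤y = subst (_≤ s) (≡.sym (m≤n⇒∣m-n∣≡n∸m x≤y)) (m≤n+o⇒m∸n≤o y x y≤x+s)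
... | inj₂ y≤x = subst (_≤ s) (≡.sym (m≤n⇒∣n-m∣≡n∸m y≤x)) (m≤n+o⇒m∸n≤o x y x≤y+s)

Close-+ : ∀ {s a b p q} → b ≤ a → Close s a b → p ≤ q → Close s p q → Close s (p + a) (q + b)
Close-+ {s} {a} {b} {p} {q} b≤a (a≤b+s , _) p≤q (_ , q≤p+s) =
  subst (p + a ≤_) (≡.sym (+-assoc q b s)) (+-mono-≤ p≤q a≤b+s) ,
  subst (q + b ≤_) (+-assoc-comm p s a) (+-mono-≤ q≤p+s b≤a)
  where
  +-assoc-comm : ∀ x y z → x + y + z ≡ x + z + y
  +-assoc-comm x y z =
    trans (+-assoc x y z) (trans (cong (x +_) (+-comm y z)) (≡.sym (+-assoc x z y)))

Close-+-or-swapped : ∀ {s a b p q} → Close s a b → Close s p q →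
  Close s (p + a) (q + b) ⊎ Close s (q + a) (p + b)
Close-+-or-swapped {a = a} {b} {p} {q} ab pq with ≤-total b a | ≤-total p q
... | inj₁ b≤a | inj₁ p≤q = inj₁ (Close-+ b≤a ab p≤q pq)
... | inj₁ b≤a | inj₂ q≤p = inj₂ (Close-+ b≤a ab q≤p (Close-sym pq))
... | inj₂ a≤b | inj₁ p≤q = inj₂ (Close-sym (Close-+ a≤b (Close-sym ab) p≤q pq))
... | inj₂ a≤b | inj₂ q≤p = inj₁ (Close-sym (Close-+ a≤b (Close-sym ab) q≤p (Close-sym pq)))

paired : ∀ n → Subset n
paired zero          = []
paired (suc zero)    = false ∷ []
paired (suc (suc n)) = true ∷ true ∷ paired n

∑-unpaired≤1 : ∀ n → sum (λ i → [ not (lookup (paired n) i) ]) ≤ 1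
∑-unpaired≤1 zero          = z≤n
∑-unpaired≤1 (suc zero)    = ≤-refl
∑-unpaired≤1 (suc (suc n)) = ∑-unpaired≤1 n

weight : ∀ {n} → Subset n → (Fin n → ℕ) → ℕ
weight X w = sum (λ i → if lookup X i then w i else 0)

record BalancedHalves (n : ℕ) (w : Fin n → ℕ) (s : ℕ) : Set where
  field
    A B      : Subset n
    disjoint : A ∩ B ≡ ⊥
    covers   : A ∪ B ≡ paired n
    ∣A∣≡n/2  : ∣ A ∣ ≡ n / 2
    ∣B∣≡n/2  : ∣ B ∣ ≡ n / 2
    balanced : Close s (weight A w) (weight B w)

∣x∷y∷p∣ : ∀ {n} x y (p : Subset n) → x ∧ y ≡ false → x ∨ y ≡ true → ∣ x ∷ y ∷ p ∣ ≡ suc ∣ p ∣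
∣x∷y∷p∣ false true  p _ _ = refl
∣x∷y∷p∣ true  false p _ _ = refl

[2+n]/2≡1+n/2 : ∀ n → suc (suc n) / 2 ≡ suc (n / 2)
[2+n]/2≡1+n/2 n = m/n≡1+[m∸n]/n {suc (suc n)} {2} (s≤s (s≤s z≤n))

placePair : ∀ {n} {w : Fin (suc (suc n)) → ℕ} {s}
  (h : BalancedHalves n (λ i → w (suc (suc i))) s) (x : Bool) →
  let open BalancedHalves h in
  Close s (weight (x ∷ not x ∷ A) w) (weight (not x ∷ x ∷ B) w) →
  BalancedHalves (suc (suc n)) w s
placePair {n} h x close = record
  { A        = x ∷ not x ∷ A
  ; B        = not x ∷ x ∷ B
  ; disjoint = cong₂ _∷_ (∧-inverseʳ x) (cong₂ _∷_ (∧-inverseˡ x) disjoint)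
  ; covers   = cong₂ _∷_ (∨-inverseʳ x) (cong₂ _∷_ (∨-inverseˡ x) covers)
  ; ∣A∣≡n/2  = size (x ∷ not x ∷ A) A (∣x∷y∷p∣ x (not x) A (∧-inverseʳ x) (∨-inverseʳ x)) ∣A∣≡n/2
  ; ∣B∣≡n/2  = size (not x ∷ x ∷ B) B (∣x∷y∷p∣ (not x) x B (∧-inverseˡ x) (∨-inverseˡ x)) ∣B∣≡n/2
  ; balanced = close
  }
  where
  open BalancedHalves h
  size : ∀ (X : Subset (suc (suc n))) (Y : Subset n) →
    ∣ X ∣ ≡ suc ∣ Y ∣ → ∣ Y ∣ ≡ n / 2 → ∣ X ∣ ≡ suc (suc n) / 2
  size _ _ X≡1+Y Y≡n/2 = trans X≡1+Y (trans (cong suc Y≡n/2) (≡.sym ([2+n]/2≡1+n/2 n)))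

extendHalves : ∀ {n} {w : Fin (suc (suc n)) → ℕ} {s} →
  BalancedHalves n (λ i → w (suc (suc i))) s → Close s (w zero) (w (suc zero)) →
  BalancedHalves (suc (suc n)) w s
extendHalves h close₀₁ with Close-+-or-swapped (BalancedHalves.balanced h) close₀₁
... | inj₁ close = placePair h true close
... | inj₂ close = placePair h false close

balancedHalves : ∀ n (w : Fin n → ℕ) s → (∀ i j → w i ≤ w j + s) → BalancedHalves n w s
balancedHalves zero w s spread =
  record { A = [] ; B = [] ; disjoint = refl ; covers = refl
         ; ∣A∣≡n/2 = refl ; ∣B∣≡n/2 = refl ; balanced = z≤n , z≤n }
balancedHalves (suc zero) w s spread =
  record { A = false ∷ [] ; B = false ∷ [] ; disjoint = refl ; covers = refl
         ; ∣A∣≡n/2 = refl ; ∣B∣≡n/2 = refl ; balanced = z≤n , z≤n }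
balancedHalves (suc (suc n)) w s spread =
  extendHalves (balancedHalves n (λ i → w (suc (suc i))) s λ i j → spread (suc (suc i)) (suc (suc j)))
               (spread zero (suc zero) , spread (suc zero) zero)

∩≡⊥⇒Disjoint : ∀ {n} {A B : Subset n} → A ∩ B ≡ ⊥ → Disjoint A B
∩≡⊥⇒Disjoint A∩B≡⊥ i i∈A×B = ∉⊥ (subst (i ∈_) A∩B≡⊥ (x∈p∩q⁺ i∈A×B))

module _ {n} (G : Graph n) where

  edgesBetween : Subset n → Subset n → ℕ
  edgesBetween X Y = ∑[ i < n ] ∑[ j < n ] [ lookup X i ∧ lookup Y j ∧ adj G i j ]

  degIn : Subset n → Fin n → ℕ
  degIn U i = ∑[ j < n ] [ lookup U j ∧ adj G i j ]

  private
    lowerEdge : Subset n → Fin n → Fin n → Bool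
    lowerEdge X i j = lookup X i ∧ lookup X j ∧ adj G i j ∧ (toℕ i <ᵇ toℕ j)

    below : Subset n → Fin n → Fin n → ℕ
    below X i j = [ lowerEdge X i j ]

  e≡∑below : ∀ X → e G X ≡ ∑[ i < n ] ∑[ j < n ] below X i j
  e≡∑below X = trans (list-sum-map-allFin (count ∘ lowerEdge X))
                     (sum-cong-≗ λ i → list-sum-map-allFin (below X i))

  adj⇒toℕ-≢ : ∀ {i j} → adj G i j ≡ true → toℕ i ≢ toℕ j
  adj⇒toℕ-≢ {i} aᵢⱼ i≡j with toℕ-injective i≡j
  ... | refl with () ← trans (≡.sym aᵢⱼ) (irrefl G i)

  edge-orientations : ∀ i j x y → [ x ∧ y ∧ adj G i j ] ≡
    [ x ∧ y ∧ adj G i j ∧ (toℕ i <ᵇ toℕ j) ] + [ y ∧ x ∧ adj G j i ∧ (toℕ j <ᵇ toℕ i) ]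
  edge-orientations i j false false = refl
  edge-orientations i j false true  = refl
  edge-orientations i j true  false = refl
  edge-orientations i j true  true  rewrite Graph.sym G j i with adj G i j in aᵢⱼ
  ... | false = refl
  ... | true  = ≡.sym ([m<ᵇn]+[n<ᵇm]≡1 (adj⇒toℕ-≢ aᵢⱼ))

  e+e≡edgesBetween : ∀ X → e G X + e G X ≡ edgesBetween X X
  e+e≡edgesBetween X = begin
    e G X + e G X
      ≡⟨ cong₂ _+_ (e≡∑below X) (trans (e≡∑below X) (∑-comm (below X))) ⟩
    ∑[ i < n ] ∑[ j < n ] below X i j + ∑[ i < n ] ∑[ j < n ] below X j i
      ≡⟨ ≡.sym (∑-distrib-+ (λ i → ∑[ j < n ] below X i j) _) ⟩
    ∑[ i < n ] (∑[ j < n ] below X i j + ∑[ j < n ] below X j i)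
      ≡⟨ sum-cong-≗ (λ i → ≡.sym (∑-distrib-+ (below X i) _)) ⟩
    ∑[ i < n ] ∑[ j < n ] (below X i j + below X j i)
      ≡⟨ sum-cong-≗ (λ i → sum-cong-≗ λ j → ≡.sym (edge-orientations i j (lookup X i) (lookup X j))) ⟩
    edgesBetween X X ∎
    where open ≡-Reasoning

  edgesBetween-comm : ∀ X Y → edgesBetween Y X ≡ edgesBetween X Y
  edgesBetween-comm X Y =
    trans (∑-comm (λ j i → [ lookup Y j ∧ lookup X i ∧ adj G j i ]))
          (sum-cong-≗ λ i → sum-cong-≗ λ j → flip i j (lookup X i) (lookup Y j))
    where
    flip : ∀ i j x y → [ y ∧ x ∧ adj G j i ] ≡ [ x ∧ y ∧ adj G i j ]
    flip i j x y rewrite Graph.sym G j i with x | y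
    ... | false | false = refl
    ... | false | true  = refl
    ... | true  | false = refl
    ... | true  | true  = refl

  edgesBetween-∪ : ∀ X {A B} → A ∩ B ≡ ⊥ →
    edgesBetween X (A ∪ B) ≡ edgesBetween X A + edgesBetween X B
  edgesBetween-∪ X {A} {B} A∩B≡⊥ = begin
    edgesBetween X (A ∪ B)
      ≡⟨ sum-cong-≗ (λ i → sum-cong-≗ λ j → split i j) ⟩
    ∑[ i < n ] ∑[ j < n ] (edge A i j + edge B i j)
      ≡⟨ sum-cong-≗ (λ i → ∑-distrib-+ (edge A i) (edge B i)) ⟩
    ∑[ i < n ] (∑[ j < n ] edge A i j + ∑[ j < n ] edge B i j)
      ≡⟨ ∑-distrib-+ (λ i → ∑[ j < n ] edge A i j) _ ⟩
    edgesBetween X A + edgesBetween X B ∎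
    where
    open ≡-Reasoning
    edge : Subset n → Fin n → Fin n → ℕ
    edge Y i j = [ lookup X i ∧ lookup Y j ∧ adj G i j ]
    disjointAt : ∀ j → lookup A j ∧ lookup B j ≡ false
    disjointAt j = trans (≡.sym (lookup-zipWith _∧_ j A B))
                         (trans (cong (λ V → lookup V j) A∩B≡⊥) (lookup-replicate j false))
    split : ∀ i j → edge (A ∪ B) i j ≡ edge A i j + edge B i j
    split i j rewrite lookup-zipWith _∨_ j A B =
      [x∧[p∨q]∧r] (lookup X i) (lookup A j) (lookup B j) (adj G i j) (disjointAt j)

  weight-degIn : ∀ X U → weight X (degIn U) ≡ edgesBetween X U
  weight-degIn X U = sum-cong-≗ λ i → weightAt i (lookup X i)
    where
    weightAt : ∀ i x → (if x then degIn U i else 0) ≡ ∑[ j < n ] [ x ∧ lookup U j ∧ adj G i j ]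
    weightAt i false = ≡.sym (sum-replicate-zero n)
    weightAt i true  = refl

  2*disc≡∣weight-weight∣ : ∀ {A B} → A ∩ B ≡ ⊥ →
    2 * disc G A B ≡ ∣ weight A (degIn (A ∪ B)) - weight B (degIn (A ∪ B)) ∣
  2*disc≡∣weight-weight∣ {A} {B} A∩B≡⊥ = begin
    2 * ∣ e G A - e G B ∣
      ≡⟨ *-distribˡ-∣-∣ 2 (e G A) (e G B) ⟩
    ∣ 2 * e G A - 2 * e G B ∣
      ≡⟨ cong₂ ∣_-_∣ (double A) (double B) ⟩
    ∣ edgesBetween A A - edgesBetween B B ∣
      ≡⟨ ≡.sym (∣m+n-m+o∣≡∣n-o∣ (edgesBetween A B) _ _) ⟩
    ∣ edgesBetween A B + edgesBetween A A - edgesBetween A B + edgesBetween B B ∣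
      ≡⟨ cong₂ ∣_-_∣ (+-comm (edgesBetween A B) _)
                     (cong (_+ edgesBetween B B) (≡.sym (edgesBetween-comm A B))) ⟩
    ∣ edgesBetween A A + edgesBetween A B - edgesBetween B A + edgesBetween B B ∣
      ≡⟨ ≡.sym (cong₂ ∣_-_∣ (degree-sum A) (degree-sum B)) ⟩
    ∣ weight A (degIn (A ∪ B)) - weight B (degIn (A ∪ B)) ∣ ∎
    where
    open ≡-Reasoning
    double : ∀ X → 2 * e G X ≡ edgesBetween X X
    double X = trans (cong (e G X +_) (+-identityʳ (e G X))) (e+e≡edgesBetween X)
    degree-sum : ∀ X → weight X (degIn (A ∪ B)) ≡ edgesBetween X A + edgesBetween X B
    degree-sum X = trans (weight-degIn X (A ∪ B)) (edgesBetween-∪ X A∩B≡⊥)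

  deg≡∑adj : ∀ i → deg G i ≡ ∑[ j < n ] [ adj G i j ]
  deg≡∑adj i = list-sum-map-allFin (λ j → [ adj G i j ])

  degIn≤deg : ∀ U i → degIn U i ≤ deg G i
  degIn≤deg U i = subst (degIn U i ≤_) (≡.sym (deg≡∑adj i))
                        (∑-mono-≤ λ j → [x∧y]≤[y] (lookup U j) (adj G i j))

  deg≤degIn+∑∁ : ∀ U i → deg G i ≤ degIn U i + ∑[ j < n ] [ not (lookup U j) ]
  deg≤degIn+∑∁ U i = begin
    deg G i
      ≡⟨ deg≡∑adj i ⟩
    ∑[ j < n ] [ adj G i j ]
      ≤⟨ ∑-mono-≤ (λ j → [y]≤[x∧y]+[¬x] (lookup U j) (adj G i j)) ⟩
    ∑[ j < n ] ([ lookup U j ∧ adj G i j ] + [ not (lookup U j) ])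
      ≡⟨ ∑-distrib-+ (λ j → [ lookup U j ∧ adj G i j ]) _ ⟩
    degIn U i + ∑[ j < n ] [ not (lookup U j) ] ∎
    where open ≤-Reasoning

  deg≤maxDeg : ∀ i → deg G i ≤ maxDeg G
  deg≤maxDeg i = ≤-foldr-⊔ (∈-map⁺ (deg G) (∈-allFin i))

  minDeg≤deg : ∀ i → minDeg G ≤ deg G i
  minDeg≤deg i = foldr-⊓-≤ (∈-map⁺ (deg G) (∈-allFin i))

  degIn-spread : ∀ U → ∑[ j < n ] [ not (lookup U j) ] ≤ 1 →
    ∀ i j → degIn U i ≤ degIn U j + ((maxDeg G ∸ minDeg G) + 1)
  degIn-spread U missing≤1 i j = begin
    degIn U i
      ≤⟨ degIn≤deg U i ⟩
    deg G i
      ≤⟨ deg≤maxDeg i ⟩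
    maxDeg G
      ≤⟨ m≤n+m∸n (maxDeg G) (minDeg G) ⟩
    minDeg G + (maxDeg G ∸ minDeg G)
      ≤⟨ +-monoˡ-≤ _ (≤-trans (minDeg≤deg j) (deg≤degIn+∑∁ U j)) ⟩
    degIn U j + ∑[ k < n ] [ not (lookup U k) ] + (maxDeg G ∸ minDeg G)
      ≤⟨ +-monoˡ-≤ _ (+-monoʳ-≤ (degIn U j) missing≤1) ⟩
    degIn U j + 1 + (maxDeg G ∸ minDeg G)
      ≡⟨ +-assoc (degIn U j) 1 _ ⟩
    degIn U j + (1 + (maxDeg G ∸ minDeg G))
      ≡⟨ cong (degIn U j +_) (+-comm 1 _) ⟩
    degIn U j + ((maxDeg G ∸ minDeg G) + 1) ∎
    where open ≤-Reasoning

mainTheorem1 : (n : ℕ) → 16 ≤ n → (G : Graph n) →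
    Σ (Subset n) λ A → Σ (Subset n) λ B → Disjoint A B ×
    ((LeTwoLgSq (disc G A B) n × ∣ A ∣ ≡ ∣ B ∣ × 2 ^ (n ∸ 2 * ∣ A ∣) ≤ n ^ 2)
    ⊎ (2 * disc G A B ≤ (maxDeg G ∸ minDeg G) + 1 × ∣ A ∣ ≡ n / 2 × ∣ B ∣ ≡ n / 2))
mainTheorem1 n _ G = A , B , ∩≡⊥⇒Disjoint disjoint , inj₂ (2*disc≤s , ∣A∣≡n/2 , ∣B∣≡n/2)
  where
  s : ℕ
  s = (maxDeg G ∸ minDeg G) + 1
  d : Fin n → ℕ
  d = degIn G (paired n)
  open BalancedHalves (balancedHalves n d s (degIn-spread G (paired n) (∑-unpaired≤1 n)))
  2*disc≤s : 2 * disc G A B ≤ s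
  2*disc≤s = begin
    2 * disc G A B
      ≡⟨ 2*disc≡∣weight-weight∣ G disjoint ⟩
    ∣ weight A (degIn G (A ∪ B)) - weight B (degIn G (A ∪ B)) ∣
      ≡⟨ cong (λ U → ∣ weight A (degIn G U) - weight B (degIn G U) ∣) covers ⟩
    ∣ weight A d - weight B d ∣
      ≤⟨ Close⇒∣-∣≤ balanced ⟩
    s ∎
    where open ≤-Reasoning
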